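{- The Kolakoski sequence $S$ is uniformly recurrent if and only if for every positive integer $n$ there exist an integer $k>n$, a positive integer $M$, and nonempty finite words $w_1,w_2,\dots$ with $|w_i|\le M$ for all $i$, such that $S=w_1w_2w_3\cdots$ and each $w_i$, regarded as a subrow of $S$ (at its position in this factorization), is $k$-regular.
   Context: Words are over the alphabet $\{1,2\}$; $|v|$ is the length of $v$. For a finite or infinite word $v=a_1a_2\cdots$, its integral $v^{ -1}$ is obtained by replacing each letter $a_i$ by $a_i$ copies of the letter $1$ if $i$ is odd and by $a_i$ copies of the letter $2$ if $i$ is even. The Kolakoski sequence $S=s_1s_2\cdots=1221121221\cdots$ is the unique infinite word over $\{1,2\}$ with $S^{ -1}=S$. For $1\le a\le b$ write $S_{a,b}=s_a\cdots s_b$; a subrow of $S$ is such an occurrence (word together with its starting position). The $S$-integral of the subrow $w=S_{a,b}$ is the subrow $w_S^{ -1}:=S_{|u^{ -1}|+1,\;|u^{ -1}|+|w^{ -1}|}$, where $u=s_1\cdots s_{a-1}$ (empty if $a=1$); iterate: $w_S^{0}=w$, $w_S^{ -n}=(w_S^{ -(n-1)})_S^{ -1}$. A subrow $w$ is $k$-regular if $|w_S^{ -h}|$ is even for all $0\le h\le k$. $S$ is uniformly recurrent if every finite subword occurs infinitely often and, for each finite subword, the gaps between consecutive occurrences are bounded. -}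

module Defs where

open import Data.Bool using (Bool; true; false; not; if_then_else_)
open import Data.Nat using (ℕ; zero; suc; _+_; _∸_; _≤_; _<_)
open import Data.Nat.Divisibility using (_∣_)
open import Data.List using (List; []; _∷_; _++_; replicate; length; lookup)
open import Data.Fin using (Fin; toℕ)
open import Data.Product using (Σ; _×_; _,_; proj₁; proj₂)
open import Relation.Binary.PropositionalEquality using (_≡_)

data Letter : Set where
  ₁ ₂ : Letter

val : Letter → ℕ
val ₁ = 1
val ₂ = 2

-- Integral of a finite word, where the first letter sits at an odd
-- position iff the Boolean flag is true.
integralFrom : Bool → List Letter → List Letter
integralFrom b []      = []
integralFrom b (a ∷ w) =
  replicate (val a) (if b then ₁ else ₂) ++ integralFrom (not b) w

integral : List Letter → List Letter
integral = integralFrom true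

-- Prefixes of the Kolakoski word: 122, and iterated integrals thereof.
-- (Each is a prefix of S, and pre k has length ≥ k + 3.)
pre : ℕ → List Letter
pre zero    = ₁ ∷ ₂ ∷ ₂ ∷ []
pre (suc k) = integral (pre k)

at : List Letter → ℕ → Letter
at []      _       = ₁
at (a ∷ w) zero    = a
at (a ∷ w) (suc n) = at w n

-- The Kolakoski sequence S, 0-indexed: kol n = s_{n+1}.
kol : ℕ → Letter
kol n = at (pre n) n

-- W p = |(s₁⋯s_p)^{-1}| = s₁ + ⋯ + s_p.
W : ℕ → ℕ
W zero    = 0
W (suc p) = W p + val (kol p)

-- A subrow of S is given by (p , ℓ): the word s_{p+1} ⋯ s_{p+ℓ}
-- (0-indexed start p, length ℓ).
Subrow : Set
Subrow = ℕ × ℕ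

-- S-integral of a subrow: S_{|u^{-1}|+1, |u^{-1}|+|w^{-1}|}, u = s₁⋯s_p.
integralS : Subrow → Subrow
integralS (p , ℓ) = (W p , W (p + ℓ) ∸ W p)

integralS^ : ℕ → Subrow → Subrow
integralS^ zero    w = w
integralS^ (suc h) w = integralS (integralS^ h w)

Regular : ℕ → Subrow → Set
Regular k w = ∀ h → h ≤ k → 2 ∣ proj₂ (integralS^ h w)

OccursAt : ℕ → ℕ → ℕ → Set
OccursAt a ℓ p = ∀ i → i < ℓ → kol (a + i) ≡ kol (p + i)

UniformlyRecurrent : Set
UniformlyRecurrent =
  ∀ a ℓ →
    (∀ N → Σ ℕ λ p → N ≤ p × OccursAt a ℓ p)
  × Σ ℕ λ G → ∀ p → OccursAt a ℓ p →
      Σ ℕ λ q → p < q × q ≤ p + G × OccursAt a ℓ q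

start : (ℕ → List Letter) → ℕ → ℕ
start w zero    = 0
start w (suc i) = start w i + length (w i)

IsFactorization : (ℕ → List Letter) → Set
IsFactorization w =
  ∀ i (j : Fin (length (w i))) → lookup (w i) j ≡ kol (start w i + toℕ j)

-- Since S = S⁻¹, run p of S starts at W p = s₁ + ⋯ + s_p, has length s_{p+1} and letter 1 or 2
-- according to the parity of p. Hence an occurrence of a prefix of S at an even position x
-- integrates to an occurrence of a longer prefix at W x, and conversely an occurrence of a long
-- enough prefix is the integral of an occurrence at an even position (no three equal letters in a
-- row keep it from starting inside a run). If S = w₁w₂⋯ with k-regular blocks of bounded length,
-- the first k integrals of every block boundary are even, so iterating integration yields
-- occurrences of ever longer prefixes, with gaps at most 2ᵏ times the block length. Conversely,
-- under uniform recurrence a long prefix occurs with bounded gaps, and un-integrating these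
-- occurrences k + 1 times gives block boundaries whose first k integrals are all even.
module Submission where

open import Defs
open import Data.Bool using (Bool; true; false; not; if_then_else_)
open import Data.Nat using (ℕ; zero; suc; _+_; _∸_; _*_; _^_; _≤_; _<_; z≤n; s≤s)
open import Data.Nat.Properties
open import Data.Nat.Divisibility using (_∣_; divides; _∣0; ∣m+n∣m⇒∣n; ∣m∸n∣n⇒∣m)
open import Data.List using (List; []; _∷_; _++_; replicate; length; take; applyUpTo)
open import Data.List.Properties
  using (++-assoc; length-++; length-replicate; length-applyUpTo; lookup-applyUpTo)
open import Data.Fin using (toℕ)
open import Data.Product using (Σ; _×_; _,_; proj₁; proj₂)
open import Data.Sum using (_⊎_; inj₁; inj₂; map₁)
open import Data.Empty using (⊥; ⊥-elim)
open import Function.Bundles using (_⇔_; mk⇔)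
open import Algebra.Properties.CommutativeSemigroup +-commutativeSemigroup using (xy∙z≈xz∙y)
open import Relation.Binary.PropositionalEquality
  using (_≡_; _≢_; refl; sym; trans; cong; cong₂; subst; subst₂; module ≡-Reasoning)
open import Relation.Nullary using (yes; no)

-- Finite words and the prefixes pre n

weight : List Letter → ℕ
weight []      = 0
weight (a ∷ w) = val a + weight w

val≥1 : ∀ a → 1 ≤ val a
val≥1 ₁ = s≤s z≤n
val≥1 ₂ = s≤s z≤n

val≤2 : ∀ a → val a ≤ 2
val≤2 ₁ = s≤s z≤n
val≤2 ₂ = ≤-refl

length≤weight : ∀ w → length w ≤ weight w
length≤weight []      = z≤n
length≤weight (a ∷ w) = +-mono-≤ (val≥1 a) (length≤weight w)

weight-take-suc : ∀ w {p} → p < length w → weight (take (suc p) w) ≡ weight (take p w) + val (at w p)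
weight-take-suc (a ∷ w) {zero}  _         = +-identityʳ (val a)
weight-take-suc (a ∷ w) {suc p} (s≤s p<n) =
  trans (cong (val a +_) (weight-take-suc w p<n)) (sym (+-assoc (val a) _ _))

weight-take-≤ : ∀ w p → weight (take p w) ≤ weight w
weight-take-≤ w       zero    = z≤n
weight-take-≤ []      (suc p) = z≤n
weight-take-≤ (a ∷ w) (suc p) = +-monoʳ-≤ (val a) (weight-take-≤ w p)

at-replicate-++ˡ : ∀ n c v {j} → j < n → at (replicate n c ++ v) j ≡ c
at-replicate-++ˡ (suc n) c v {zero}  _         = refl
at-replicate-++ˡ (suc n) c v {suc j} (s≤s j<n) = at-replicate-++ˡ n c v j<n

at-replicate-++ʳ : ∀ n c v j → at (replicate n c ++ v) (n + j) ≡ at v j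
at-replicate-++ʳ zero    c v j = refl
at-replicate-++ʳ (suc n) c v j = at-replicate-++ʳ n c v j

length-integralFrom : ∀ b w → length (integralFrom b w) ≡ weight w
length-integralFrom b []      = refl
length-integralFrom b (a ∷ w) = begin
  length (replicate (val a) _ ++ integralFrom (not b) w)
    ≡⟨ length-++ (replicate (val a) _) ⟩
  length (replicate (val a) _) + length (integralFrom (not b) w)
    ≡⟨ cong₂ _+_ (length-replicate (val a)) (length-integralFrom (not b) w) ⟩
  val a + weight w ∎
  where open ≡-Reasoning

-- The letter that integralFrom b writes for the p-th letter of its argument.
runLetterFrom : Bool → ℕ → Letter
runLetterFrom b zero    = if b then ₁ else ₂
runLetterFrom b (suc p) = runLetterFrom (not b) p

runLetter : ℕ → Letter
runLetter = runLetterFrom true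

at-integralFrom : ∀ b w {p i} → p < length w → i < val (at w p) →
                  at (integralFrom b w) (weight (take p w) + i) ≡ runLetterFrom b p
at-integralFrom b (a ∷ w) {zero}  {i} _         i<a = at-replicate-++ˡ (val a) _ _ i<a
at-integralFrom b (a ∷ w) {suc p} {i} (s≤s p<n) i<a = begin
  at (replicate (val a) _ ++ integralFrom (not b) w) (val a + weight (take p w) + i)
    ≡⟨ cong (at (replicate (val a) _ ++ _)) (+-assoc (val a) _ i) ⟩
  at (replicate (val a) _ ++ integralFrom (not b) w) (val a + (weight (take p w) + i))
    ≡⟨ at-replicate-++ʳ (val a) _ _ _ ⟩
  at (integralFrom (not b) w) (weight (take p w) + i)
    ≡⟨ at-integralFrom (not b) w p<n i<a ⟩
  runLetterFrom (not b) p ∎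
  where open ≡-Reasoning

_⊑_ : List Letter → List Letter → Set
u ⊑ v = Σ (List Letter) λ s → v ≡ u ++ s

⊑-trans : ∀ {u v x} → u ⊑ v → v ⊑ x → u ⊑ x
⊑-trans {u} (s , refl) (t , refl) = s ++ t , ++-assoc u s t

integralFrom-⊑ : ∀ b {u v} → u ⊑ v → integralFrom b u ⊑ integralFrom b v
integralFrom-⊑ b {[]}    {v} _              = integralFrom b v , refl
integralFrom-⊑ b {a ∷ u} (s , refl) with integralFrom-⊑ (not b) {u} (s , refl)
... | t , eq = t , trans (cong (replicate (val a) _ ++_) eq) (sym (++-assoc (replicate (val a) _) _ t))

at-⊑ : ∀ {u v} → u ⊑ v → ∀ {j} → j < length u → at v j ≡ at u j
at-⊑ {a ∷ u} (s , refl) {zero}  _         = refl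
at-⊑ {a ∷ u} (s , refl) {suc j} (s≤s j<n) = at-⊑ {u} (s , refl) j<n

pre0-⊑ : ∀ n → pre 0 ⊑ pre n
pre0-⊑ zero    = [] , refl
pre0-⊑ (suc n) = ⊑-trans (₁ ∷ ₁ ∷ [] , refl) (integralFrom-⊑ true (pre0-⊑ n))

pre-⊑ : ∀ {m n} → m ≤ n → pre m ⊑ pre n
pre-⊑ {zero}  {n}     _         = pre0-⊑ n
pre-⊑ {suc m} {suc n} (s≤s m≤n) = integralFrom-⊑ true (pre-⊑ m≤n)

-- pre n begins with 122, whose weight exceeds its length by 2.
length-pre-< : ∀ n → length (pre n) < length (pre (suc n))
length-pre-< n with pre0-⊑ n
... | s , eq = begin-strict
  length (pre n)         ≡⟨ cong length eq ⟩
  3 + length s           <⟨ s≤s (s≤s (s≤s (s≤s (m≤n+m (length s) 1)))) ⟩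
  5 + length s           ≤⟨ +-monoʳ-≤ 5 (length≤weight s) ⟩
  weight (pre 0 ++ s)    ≡⟨ cong weight eq ⟨
  weight (pre n)         ≡⟨ length-integralFrom true (pre n) ⟨
  length (pre (suc n))   ∎
  where open ≤-Reasoning

n<length-pre : ∀ n → n < length (pre n)
n<length-pre zero    = s≤s z≤n
n<length-pre (suc n) = ≤-trans (s≤s (n<length-pre n)) (length-pre-< n)

kol-pre : ∀ m {n} → n < length (pre m) → kol n ≡ at (pre m) n
kol-pre m {n} n<len with ≤-total n m
... | inj₁ n≤m = sym (at-⊑ (pre-⊑ n≤m) (n<length-pre n))
... | inj₂ m≤n = at-⊑ (pre-⊑ m≤n) n<len

-- Runs of S

W≡weight-take : ∀ m {p} → p ≤ length (pre m) → W p ≡ weight (take p (pre m))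
W≡weight-take m {zero}  _   = refl
W≡weight-take m {suc p} p<n = begin
  W p + val (kol p)
    ≡⟨ cong₂ _+_ (W≡weight-take m (<⇒≤ p<n)) (cong val (kol-pre m p<n)) ⟩
  weight (take p (pre m)) + val (at (pre m) p)
    ≡⟨ weight-take-suc (pre m) p<n ⟨
  weight (take (suc p) (pre m)) ∎
  where open ≡-Reasoning

W-suc≤length-pre : ∀ p → W (suc p) ≤ length (pre (suc p))
W-suc≤length-pre p = begin
  W (suc p)                     ≡⟨ W≡weight-take p (n<length-pre p) ⟩
  weight (take (suc p) (pre p)) ≤⟨ weight-take-≤ (pre p) (suc p) ⟩
  weight (pre p)                ≡⟨ length-integralFrom true (pre p) ⟨
  length (pre (suc p))          ∎
  where open ≤-Reasoning

kol-run : ∀ p {i} → i < val (kol p) → kol (W p + i) ≡ runLetter p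
kol-run p {i} i<kp = begin
  kol (W p + i)
    ≡⟨ kol-pre (suc p) (<-≤-trans (+-monoʳ-< (W p) i<kp) (W-suc≤length-pre p)) ⟩
  at (pre (suc p)) (W p + i)
    ≡⟨ cong (λ t → at (pre (suc p)) (t + i)) (W≡weight-take p (<⇒≤ p<length)) ⟩
  at (pre (suc p)) (weight (take p (pre p)) + i)
    ≡⟨ at-integralFrom true (pre p) p<length (subst (λ c → i < val c) (kol-pre p p<length) i<kp) ⟩
  runLetter p ∎
  where
  open ≡-Reasoning
  p<length : p < length (pre p)
  p<length = n<length-pre p

kol-W : ∀ p → kol (W p) ≡ runLetter p
kol-W p = trans (cong kol (sym (+-identityʳ (W p)))) (kol-run p (val≥1 (kol p)))

flip : Letter → Letter
flip ₁ = ₂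
flip ₂ = ₁

flip-≢ : ∀ c → flip c ≢ c
flip-≢ ₁ ()
flip-≢ ₂ ()

runLetterFrom-not : ∀ b n → runLetterFrom (not b) n ≡ flip (runLetterFrom b n)
runLetterFrom-not true  zero    = refl
runLetterFrom-not false zero    = refl
runLetterFrom-not b     (suc n) = runLetterFrom-not (not b) n

runLetter-suc : ∀ n → runLetter (suc n) ≡ flip (runLetter n)
runLetter-suc = runLetterFrom-not true

runLetter-+-even : ∀ {x} s → 2 ∣ x → runLetter (x + s) ≡ runLetter s
runLetter-+-even s (divides q refl) = go q
  where
  go : ∀ q → runLetter (q * 2 + s) ≡ runLetter s
  go zero    = refl
  go (suc q) = go q

runLetter-even : ∀ {n} → 2 ∣ n → runLetter n ≡ ₁
runLetter-even {n} n-even = trans (cong runLetter (sym (+-identityʳ n))) (runLetter-+-even 0 n-even)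

runLetter≡₁⇒even : ∀ n → runLetter n ≡ ₁ → 2 ∣ n
runLetter≡₁⇒even zero          _ = 2 ∣0
runLetter≡₁⇒even (suc (suc n)) e with runLetter≡₁⇒even n e
... | divides q refl = divides (suc q) refl

Expanding : (ℕ → ℕ) → Set
Expanding f = ∀ x d → f x + d ≤ f (x + d)

module _ {f : ℕ → ℕ} (f-expanding : Expanding f) where

  expanding-mono : ∀ {x y} → x ≤ y → f x ≤ f y
  expanding-mono {x} {y} x≤y = begin
    f x             ≤⟨ m≤m+n (f x) (y ∸ x) ⟩
    f x + (y ∸ x)   ≤⟨ f-expanding x (y ∸ x) ⟩
    f (x + (y ∸ x)) ≡⟨ cong f (m+[n∸m]≡n x≤y) ⟩
    f y             ∎
    where open ≤-Reasoning

  expanding-strict : ∀ {x y} → x < y → f x < f y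
  expanding-strict {x} {y} x<y = begin-strict
    f x       <⟨ n<1+n (f x) ⟩
    1 + f x   ≡⟨ +-comm 1 (f x) ⟩
    f x + 1   ≤⟨ f-expanding x 1 ⟩
    f (x + 1) ≤⟨ expanding-mono (subst (_≤ y) (+-comm 1 x) x<y) ⟩
    f y       ∎
    where open ≤-Reasoning

  expanding-cancel-< : ∀ {x y} → f x < f y → x < y
  expanding-cancel-< {x} {y} fx<fy with x <? y
  ... | yes x<y = x<y
  ... | no  x≮y = ⊥-elim (<⇒≱ fx<fy (expanding-mono (≮⇒≥ x≮y)))

  expanding-gap : ∀ {x y g} → x ≤ y → f y ≤ f x + g → y ∸ x ≤ g
  expanding-gap {x} {y} {g} x≤y fy≤fx+g = +-cancelˡ-≤ (f x) _ _ (begin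
    f x + (y ∸ x)   ≤⟨ f-expanding x (y ∸ x) ⟩
    f (x + (y ∸ x)) ≡⟨ cong f (m+[n∸m]≡n x≤y) ⟩
    f y             ≤⟨ fy≤fx+g ⟩
    f x + g         ∎)
    where open ≤-Reasoning

W-expanding : Expanding W
W-expanding x zero    = ≤-reflexive (trans (+-identityʳ (W x)) (cong W (sym (+-identityʳ x))))
W-expanding x (suc d) = begin
  W x + suc d               ≡⟨ +-suc (W x) d ⟩
  suc (W x + d)             ≤⟨ s≤s (W-expanding x d) ⟩
  suc (W (x + d))           ≤⟨ subst (_≤ W (x + d) + val (kol (x + d))) (+-comm (W (x + d)) 1)
                                   (+-monoʳ-≤ (W (x + d)) (val≥1 (kol (x + d)))) ⟩
  W (suc (x + d))           ≡⟨ cong W (+-suc x d) ⟨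
  W (x + suc d)             ∎
  where open ≤-Reasoning

W-+-≤ : ∀ x d → W (x + d) ≤ W x + 2 * d
W-+-≤ x zero    = ≤-reflexive (trans (cong W (+-identityʳ x)) (sym (+-identityʳ (W x))))
W-+-≤ x (suc d) = begin
  W (x + suc d)                 ≡⟨ cong W (+-suc x d) ⟩
  W (x + d) + val (kol (x + d)) ≤⟨ +-mono-≤ (W-+-≤ x d) (val≤2 (kol (x + d))) ⟩
  W x + 2 * d + 2               ≡⟨ +-assoc (W x) (2 * d) 2 ⟩
  W x + (2 * d + 2)             ≡⟨ cong (W x +_) (trans (+-comm (2 * d) 2) (sym (*-suc 2 d))) ⟩
  W x + 2 * suc d               ∎
  where open ≤-Reasoning

W-mono : ∀ {x y} → x ≤ y → W x ≤ W y
W-mono = expanding-mono W-expanding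

W-strict : ∀ {x y} → x < y → W x < W y
W-strict = expanding-strict W-expanding

W-cancel-< : ∀ {x y} → W x < W y → x < y
W-cancel-< = expanding-cancel-< W-expanding

locateRun : ∀ z → Σ ℕ λ r → W r ≤ z × z < W (suc r)
locateRun zero = 0 , z≤n , W-strict {0} {1} (s≤s z≤n)
locateRun (suc z) with locateRun z
... | r , Wr≤z , z<Wr+1 with suc z <? W (suc r)
...   | yes z+1<Wr+1 = r , m≤n⇒m≤1+n Wr≤z , z+1<Wr+1
...   | no  z+1≮Wr+1 = suc r , ≤-reflexive (sym z+1≡Wr+1) ,
                        subst (_< W (suc (suc r))) (sym z+1≡Wr+1) (W-strict (n<1+n (suc r)))
  where
  z+1≡Wr+1 : suc z ≡ W (suc r)
  z+1≡Wr+1 = ≤-antisym z<Wr+1 (≮⇒≥ z+1≮Wr+1)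

kol-inRun : ∀ s {z} → W s ≤ z → z < W (suc s) → kol z ≡ runLetter s
kol-inRun s {z} Ws≤z z<Ws+1 = begin
  kol z                 ≡⟨ cong kol Ws+[z∸Ws]≡z ⟨
  kol (W s + (z ∸ W s)) ≡⟨ kol-run s (+-cancelˡ-< (W s) _ _ Ws+[z∸Ws]<Ws+ks) ⟩
  runLetter s           ∎
  where
  open ≡-Reasoning
  Ws+[z∸Ws]≡z : W s + (z ∸ W s) ≡ z
  Ws+[z∸Ws]≡z = m+[n∸m]≡n Ws≤z
  Ws+[z∸Ws]<Ws+ks : W s + (z ∸ W s) < W s + val (kol s)
  Ws+[z∸Ws]<Ws+ks = subst (_< W (suc s)) (sym Ws+[z∸Ws]≡z) z<Ws+1

-- A run has length at most 2, so the run containing z ends at z or z + 1.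
run-end : ∀ s {z} → W s ≤ z → z < W (suc s) → W (suc s) ≡ suc z ⊎ W (suc s) ≡ suc (suc z)
run-end s {z} Ws≤z z<Ws+1 =
  map₁ (λ Ws+1<z+2 → ≤-antisym (≤-pred Ws+1<z+2) z<Ws+1) (m≤n⇒m<n∨m≡n Ws+1≤z+2)
  where
  Ws+1≤z+2 : W (suc s) ≤ suc (suc z)
  Ws+1≤z+2 = ≤-trans (+-mono-≤ Ws≤z (val≤2 (kol s))) (≤-reflexive (+-comm z 2))

kol-no-triple : ∀ z → kol z ≡ kol (suc z) → kol z ≡ kol (suc (suc z)) → ⊥
kol-no-triple z z≡z+1 z≡z+2 with locateRun z
... | s , Ws≤z , z<Ws+1 = flip-≢ (runLetter s) (begin
  flip (runLetter s) ≡⟨ runLetter-suc s ⟨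
  runLetter (suc s)  ≡⟨ kol-W (suc s) ⟨
  kol (W (suc s))    ≡⟨ z≡next-run ⟨
  kol z              ≡⟨ kol-inRun s Ws≤z z<Ws+1 ⟩
  runLetter s        ∎)
  where
  open ≡-Reasoning
  z≡next-run : kol z ≡ kol (W (suc s))
  z≡next-run with run-end s Ws≤z z<Ws+1
  ... | inj₁ e = trans z≡z+1 (cong kol (sym e))
  ... | inj₂ e = trans z≡z+2 (cong kol (sym e))

twoRun⇒second : ∀ p → kol p ≡ ₂ → kol (W p + 1) ≡ runLetter p
twoRun⇒second p kp≡₂ = kol-run p (subst (λ c → 1 < val c) (sym kp≡₂) ≤-refl)

oneRun⇒second : ∀ p → kol p ≡ ₁ → kol (W p + 1) ≡ runLetter (suc p)
oneRun⇒second p kp≡₁ = trans (cong (λ c → kol (W p + val c)) (sym kp≡₁)) (kol-W (suc p))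

second⇒twoRun : ∀ p → kol (W p + 1) ≡ runLetter p → kol p ≡ ₂
second⇒twoRun p second≡rp with kol p in kp
... | ₂ = refl
... | ₁ = ⊥-elim (flip-≢ (runLetter p) (begin
  flip (runLetter p) ≡⟨ runLetter-suc p ⟨
  runLetter (suc p)  ≡⟨ oneRun⇒second p kp ⟨
  kol (W p + 1)      ≡⟨ second≡rp ⟩
  runLetter p        ∎))
  where open ≡-Reasoning

twoRun-transfer : ∀ p q → runLetter p ≡ runLetter q → kol (W p + 1) ≡ kol (W q + 1) →
                  kol q ≡ ₂ → kol p ≡ ₂
twoRun-transfer p q rp≡rq seconds kq≡₂ =
  second⇒twoRun p (trans seconds (trans (twoRun⇒second q kq≡₂) (sym rp≡rq)))

kol-from-second : ∀ p q → runLetter p ≡ runLetter q → kol (W p + 1) ≡ kol (W q + 1) →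
                  kol p ≡ kol q
kol-from-second p q rp≡rq seconds with kol p in kp | kol q in kq
... | ₁ | ₁ = refl
... | ₂ | ₂ = refl
... | ₁ | ₂ = ⊥-elim (flip-≢ ₁ (trans (sym (twoRun-transfer p q rp≡rq seconds kq)) kp))
... | ₂ | ₁ = ⊥-elim (flip-≢ ₁ (trans (sym (twoRun-transfer q p (sym rp≡rq) (sym seconds) kp)) kq))

-- Integrating occurrences of prefixes

OccursAt-shorter : ∀ {a ℓ ℓ′ p} → ℓ′ ≤ ℓ → OccursAt a ℓ p → OccursAt a ℓ′ p
OccursAt-shorter ℓ′≤ℓ occ i i<ℓ′ = occ i (<-≤-trans i<ℓ′ ℓ′≤ℓ)

OccursAt-extend : ∀ {a ℓ p} → OccursAt a ℓ p → kol (a + ℓ) ≡ kol (p + ℓ) → OccursAt a (suc ℓ) p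
OccursAt-extend occ next i i<ℓ+1 with m≤n⇒m<n∨m≡n (≤-pred i<ℓ+1)
... | inj₁ i<ℓ = occ i i<ℓ
... | inj₂ refl = next

OccursAt-factor : ∀ {m} p a {ℓ} → OccursAt 0 m p → a + ℓ ≤ m → OccursAt a ℓ (p + a)
OccursAt-factor p a occ a+ℓ≤m t t<ℓ =
  trans (occ (a + t) (<-≤-trans (+-monoʳ-< a t<ℓ) a+ℓ≤m)) (cong kol (sym (+-assoc p a t)))

W-shift : ∀ {m x} → OccursAt 0 m x → ∀ i → i ≤ m → W (x + i) ≡ W x + W i
W-shift {m} {x} occ zero    _   = trans (cong W (+-identityʳ x)) (sym (+-identityʳ (W x)))
W-shift {m} {x} occ (suc i) i<m = begin
  W (x + suc i)                 ≡⟨ cong W (+-suc x i) ⟩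
  W (x + i) + val (kol (x + i))
    ≡⟨ cong₂ _+_ (W-shift {m} {x} occ i (<⇒≤ i<m)) (cong val (sym (occ i i<m))) ⟩
  W x + W i + val (kol i)
    ≡⟨ +-assoc (W x) (W i) _ ⟩
  W x + W (suc i) ∎
  where open ≡-Reasoning

integral-preserves-prefix : ∀ {m x} → 2 ∣ x → OccursAt 0 m x → OccursAt 0 (W m) (W x)
integral-preserves-prefix {m} {x} x-even occ d d<Wm with locateRun d
... | s , Ws≤d , d<Ws+1 = begin
  kol d             ≡⟨ kol-inRun s Ws≤d d<Ws+1 ⟩
  runLetter s       ≡⟨ runLetter-+-even s x-even ⟨
  runLetter (x + s) ≡⟨ kol-inRun (x + s) W[x+s]≤Wx+d Wx+d<W[x+s+1] ⟨
  kol (W x + d)     ∎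
  where
  open ≡-Reasoning
  s<m : s < m
  s<m = W-cancel-< (≤-<-trans Ws≤d d<Wm)
  W[x+s]≤Wx+d : W (x + s) ≤ W x + d
  W[x+s]≤Wx+d = subst (_≤ W x + d) (sym (W-shift {m} {x} occ s (<⇒≤ s<m))) (+-monoʳ-≤ (W x) Ws≤d)
  Wx+d<W[x+s+1] : W x + d < W (suc (x + s))
  Wx+d<W[x+s+1] = subst (W x + d <_) (trans (sym (W-shift {m} {x} occ (suc s) s<m)) (cong W (+-suc x s)))
                    (+-monoʳ-< (W x) d<Ws+1)

-- The letters s_{W i + 2} fix the run lengths s_{i+1} one at a time.
integral-reflects-prefix : ∀ {x} m → 2 ∣ x → OccursAt 0 (suc (W m)) (W x) → OccursAt 0 m x
integral-reflects-prefix zero    _      _   i ()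
integral-reflects-prefix {x} (suc m) x-even occ =
  OccursAt-extend {0} {m} {x} occ-m (kol-from-second m (x + m) (sym (runLetter-+-even m x-even)) seconds)
  where
  open ≡-Reasoning
  occ-m : OccursAt 0 m x
  occ-m = integral-reflects-prefix m x-even
            (OccursAt-shorter {0} {p = W x} (s≤s (W-mono (n≤1+n m))) occ)
  seconds : kol (W m + 1) ≡ kol (W (x + m) + 1)
  seconds = begin
    kol (W m + 1)         ≡⟨ occ (W m + 1) (s≤s (+-monoʳ-≤ (W m) (val≥1 (kol m)))) ⟩
    kol (W x + (W m + 1)) ≡⟨ cong kol (+-assoc (W x) (W m) 1) ⟨
    kol (W x + W m + 1)   ≡⟨ cong (λ t → kol (t + 1)) (W-shift {m} {x} occ-m m ≤-refl) ⟨
    kol (W (x + m) + 1)   ∎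

-- A prefix 12211 starting in the middle of a run would force three runs of length 2 in a row.
prefix-not-inside-run : ∀ r {q} → W r < q → q < W (suc r) → OccursAt 0 5 q → ⊥
prefix-not-inside-run r {q} Wr<q q<Wr+1 occ =
  kol-no-triple r (trans kr≡₂ (sym kr+1≡₂)) (trans kr≡₂ (sym kr+2≡₂))
  where
  open ≡-Reasoning
  kol-q+ : ∀ i → i < 5 → kol (q + i) ≡ kol i
  kol-q+ i i<5 = sym (occ i i<5)
  Wr+1≤Wr+2 : W (suc r) ≤ suc (suc (W r))
  Wr+1≤Wr+2 = ≤-trans (+-monoʳ-≤ (W r) (val≤2 (kol r))) (≤-reflexive (+-comm (W r) 2))
  q≡Wr+1 : q ≡ suc (W r)
  q≡Wr+1 = ≤-antisym (≤-pred (≤-trans q<Wr+1 Wr+1≤Wr+2)) Wr<q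
  W[r+1]≡q+1 : W (suc r) ≡ suc q
  W[r+1]≡q+1 = ≤-antisym (≤-trans Wr+1≤Wr+2 (s≤s Wr<q)) q<Wr+1
  rr≡₁ : runLetter r ≡ ₁
  rr≡₁ = begin
    runLetter r ≡⟨ kol-inRun r (<⇒≤ Wr<q) q<Wr+1 ⟨
    kol q       ≡⟨ cong kol (+-identityʳ q) ⟨
    kol (q + 0) ≡⟨ kol-q+ 0 (s≤s z≤n) ⟩
    ₁           ∎
  kr≡₂ : kol r ≡ ₂
  kr≡₂ = second⇒twoRun r (begin
    kol (W r + 1) ≡⟨ cong kol (trans (+-comm (W r) 1) (sym q≡Wr+1)) ⟩
    kol q         ≡⟨ kol-inRun r (<⇒≤ Wr<q) q<Wr+1 ⟩
    runLetter r   ∎)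
  kr+1≡₂ : kol (suc r) ≡ ₂
  kr+1≡₂ = second⇒twoRun (suc r) (begin
    kol (W (suc r) + 1) ≡⟨ cong (λ t → kol (t + 1)) W[r+1]≡q+1 ⟩
    kol (suc q + 1)     ≡⟨ cong kol (+-suc q 1) ⟨
    kol (q + 2)         ≡⟨ kol-q+ 2 (s≤s (s≤s (s≤s z≤n))) ⟩
    ₂                   ≡⟨ cong flip rr≡₁ ⟨
    flip (runLetter r)  ≡⟨ runLetter-suc r ⟨
    runLetter (suc r)   ∎)
  kr+2≡₂ : kol (suc (suc r)) ≡ ₂
  kr+2≡₂ = second⇒twoRun (suc (suc r)) (begin
    kol (W (suc r) + val (kol (suc r)) + 1)
      ≡⟨ cong₂ (λ t c → kol (t + val c + 1)) W[r+1]≡q+1 kr+1≡₂ ⟩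
    kol (suc q + 2 + 1)
      ≡⟨ cong kol (trans (cong suc (+-assoc q 2 1)) (sym (+-suc q 3))) ⟩
    kol (q + 4)
      ≡⟨ kol-q+ 4 ≤-refl ⟩
    ₁
      ≡⟨ rr≡₁ ⟨
    runLetter (suc (suc r)) ∎)

prefix-occurrence-is-integral : ∀ m {q} → OccursAt 0 (W m + 5) q →
                                Σ ℕ λ r → W r ≡ q × 2 ∣ r × OccursAt 0 m r
prefix-occurrence-is-integral m {q} occ with locateRun q
... | r , Wr≤q , q<Wr+1 with m≤n⇒m<n∨m≡n Wr≤q
...   | inj₁ Wr<q =
  ⊥-elim (prefix-not-inside-run r Wr<q q<Wr+1 (OccursAt-shorter {0} {p = q} (m≤n+m 5 (W m)) occ))
...   | inj₂ Wr≡q = r , Wr≡q , r-even , integral-reflects-prefix m r-even occ-at-Wr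
  where
  r-even : 2 ∣ r
  r-even = runLetter≡₁⇒even r (sym (begin
    ₁           ≡⟨ occ 0 (≤-trans (s≤s z≤n) (m≤n+m 5 (W m))) ⟩
    kol (q + 0) ≡⟨ cong kol (+-identityʳ q) ⟩
    kol q       ≡⟨ cong kol Wr≡q ⟨
    kol (W r)   ≡⟨ kol-W r ⟩
    runLetter r ∎))
    where open ≡-Reasoning
  occ-at-Wr : OccursAt 0 (suc (W m)) (W r)
  occ-at-Wr = subst (OccursAt 0 (suc (W m))) (sym Wr≡q)
    (OccursAt-shorter {0} {p = q} (subst (_≤ W m + 5) (+-comm (W m) 1) (+-monoʳ-≤ (W m) (s≤s z≤n))) occ)

-- Iterated integrals and regular subrows

W^ : ℕ → ℕ → ℕ
W^ zero    x = x
W^ (suc h) x = W (W^ h x)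

W^-expanding : ∀ h → Expanding (W^ h)
W^-expanding zero    x d = ≤-refl
W^-expanding (suc h) x d = ≤-trans (W-expanding (W^ h x) d) (W-mono (W^-expanding h x d))

W^-+-≤ : ∀ h x d → W^ h (x + d) ≤ W^ h x + 2 ^ h * d
W^-+-≤ zero    x d = ≤-reflexive (cong (x +_) (sym (*-identityˡ d)))
W^-+-≤ (suc h) x d = begin
  W (W^ h (x + d))              ≤⟨ W-mono (W^-+-≤ h x d) ⟩
  W (W^ h x + 2 ^ h * d)        ≤⟨ W-+-≤ (W^ h x) (2 ^ h * d) ⟩
  W (W^ h x) + 2 * (2 ^ h * d)  ≡⟨ cong (W (W^ h x) +_) (*-assoc 2 (2 ^ h) d) ⟨
  W (W^ h x) + 2 ^ suc h * d    ∎
  where open ≤-Reasoning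

W^-zero : ∀ h → W^ h 0 ≡ 0
W^-zero zero    = refl
W^-zero (suc h) = cong W (W^-zero h)

W-inflationary : ∀ y → 2 ≤ y → suc y ≤ W y
W-inflationary (suc (suc d)) _         = W-expanding 2 d
W-inflationary (suc zero)    (s≤s ())

j+2≤W^j2 : ∀ j → j + 2 ≤ W^ j 2
j+2≤W^j2 zero    = ≤-refl
j+2≤W^j2 (suc j) =
  ≤-trans (s≤s (j+2≤W^j2 j)) (W-inflationary (W^ j 2) (≤-trans (m≤n+m 2 j) (j+2≤W^j2 j)))

integralS^-≡ : ∀ h c ℓ → integralS^ h (c , ℓ) ≡ (W^ h c , W^ h (c + ℓ) ∸ W^ h c)
integralS^-≡ zero    c ℓ = cong (c ,_) (sym (m+n∸m≡n c ℓ))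
integralS^-≡ (suc h) c ℓ
  rewrite integralS^-≡ h c ℓ | m+[n∸m]≡n (expanding-mono (W^-expanding h) (m≤m+n c ℓ)) = refl

EvenIntegrals : ℕ → ℕ → Set
EvenIntegrals k x = ∀ h → h ≤ k → 2 ∣ W^ h x

EvenIntegrals-≤ : ∀ {k k′ x} → k ≤ k′ → EvenIntegrals k′ x → EvenIntegrals k x
EvenIntegrals-≤ k≤k′ even h h≤k = even h (≤-trans h≤k k≤k′)

EvenIntegrals-suc : ∀ {k x} → EvenIntegrals k x → 2 ∣ W^ (suc k) x → EvenIntegrals (suc k) x
EvenIntegrals-suc even top h h≤k+1 with m≤n⇒m<n∨m≡n h≤k+1
... | inj₁ h<k+1 = even h (≤-pred h<k+1)
... | inj₂ refl  = top

EvenIntegrals-0 : ∀ k → EvenIntegrals k 0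
EvenIntegrals-0 k h _ = subst (2 ∣_) (sym (W^-zero h)) (2 ∣0)

regular-between : ∀ {k a b} → a ≤ b → EvenIntegrals k a → EvenIntegrals k b → Regular k (a , b ∸ a)
regular-between {k} {a} {b} a≤b a-even b-even h h≤k
  rewrite integralS^-≡ h a (b ∸ a) | m+[n∸m]≡n a≤b =
  ∣m+n∣m⇒∣n (subst (2 ∣_) (sym (m+[n∸m]≡n (expanding-mono (W^-expanding h) a≤b))) (b-even h h≤k))
            (a-even h h≤k)

regular-extends : ∀ {k a ℓ} → Regular k (a , ℓ) → EvenIntegrals k a → EvenIntegrals k (a + ℓ)
regular-extends {k} {a} {ℓ} reg a-even h h≤k =
  ∣m∸n∣n⇒∣m 2 (expanding-mono (W^-expanding h) (m≤m+n a ℓ))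
    (subst (λ w → 2 ∣ proj₂ w) (integralS^-≡ h a ℓ) (reg h h≤k)) (a-even h h≤k)

prefix-at-W^ : ∀ j {c} → EvenIntegrals (suc j) c → OccursAt 0 (W^ j 2) (W^ (suc (suc j)) c)
prefix-at-W^ zero {c} even = λ
  { zero          _ → sym (begin
      kol (W (W c) + 0)      ≡⟨ cong kol (+-identityʳ (W (W c))) ⟩
      kol (W (W c))          ≡⟨ kol-W (W c) ⟩
      runLetter (W c)        ≡⟨ runLetter-even (even 1 ≤-refl) ⟩
      ₁                      ∎)
  ; (suc zero)    _ → sym (begin
      kol (W (W c) + 1)      ≡⟨ oneRun⇒second (W c) (trans (kol-W c) (runLetter-even (even 0 z≤n))) ⟩
      runLetter (suc (W c))  ≡⟨ runLetter-suc (W c) ⟩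
      flip (runLetter (W c)) ≡⟨ cong flip (runLetter-even (even 1 ≤-refl)) ⟩
      ₂                      ∎)
  ; (suc (suc i)) (s≤s (s≤s ()))
  }
  where open ≡-Reasoning
prefix-at-W^ (suc j) even =
  integral-preserves-prefix (even (suc (suc j)) ≤-refl)
    (prefix-at-W^ j (EvenIntegrals-≤ (n≤1+n (suc j)) even))

derivableLength : ℕ → ℕ
derivableLength zero    = 5
derivableLength (suc k) = W (derivableLength k) + 5

prefix-occurrence-is-iterated-integral :
  ∀ k {q} → OccursAt 0 (derivableLength k) q → Σ ℕ λ x → W^ (suc k) x ≡ q × EvenIntegrals k x
prefix-occurrence-is-iterated-integral zero occ with prefix-occurrence-is-integral 0 occ
... | r , Wr≡q , r-even , _ = r , Wr≡q , λ { zero _ → r-even }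
prefix-occurrence-is-iterated-integral (suc k) occ
  with prefix-occurrence-is-integral (derivableLength k) occ
... | r , Wr≡q , r-even , occ-r with prefix-occurrence-is-iterated-integral k occ-r
...   | x , W^x≡r , x-even =
  x , trans (cong W W^x≡r) Wr≡q , EvenIntegrals-suc x-even (subst (2 ∣_) (sym W^x≡r) r-even)

-- Occurrence sequences and factorizations

RecursUniformly : ℕ → ℕ → Set
RecursUniformly a ℓ =
  (∀ N → Σ ℕ λ p → N ≤ p × OccursAt a ℓ p)
  × Σ ℕ λ G → ∀ p → OccursAt a ℓ p → Σ ℕ λ q → p < q × q ≤ p + G × OccursAt a ℓ q

record OccurrenceSequence (a ℓ : ℕ) : Set where
  field
    pos     : ℕ → ℕ
    gap     : ℕ
    pos-<   : ∀ i → pos i < pos (suc i)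
    pos-gap : ∀ i → pos (suc i) ≤ pos i + gap
    occurs  : ∀ i → OccursAt a ℓ (pos i)

bounded-gaps : (f : ℕ → ℕ) {D : ℕ} → (∀ i → f i < f (suc i)) → (∀ i → f (suc i) ≤ f i + D) →
               ∀ p → Σ ℕ λ i → p < f i × f i ≤ p + (f 0 + D)
bounded-gaps f {D} f-< f-gap zero = 1 , ≤-trans (s≤s z≤n) (f-< 0) , f-gap 0
bounded-gaps f {D} f-< f-gap (suc p) with bounded-gaps f f-< f-gap p
... | i , p<fi , fi≤p+C with suc p <? f i
...   | yes p+1<fi = i , p+1<fi , m≤n⇒m≤1+n fi≤p+C
...   | no  p+1≮fi = suc i , subst (_< f (suc i)) fi≡p+1 (f-< i) , (begin
  f (suc i)           ≤⟨ f-gap i ⟩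
  f i + D             ≡⟨ cong (_+ D) fi≡p+1 ⟩
  suc p + D           ≤⟨ +-monoʳ-≤ (suc p) (m≤n+m D (f 0)) ⟩
  suc p + (f 0 + D)   ∎)
  where
  open ≤-Reasoning
  fi≡p+1 : f i ≡ suc p
  fi≡p+1 = ≤-antisym (≮⇒≥ p+1≮fi) p<fi

recursUniformly : ∀ {a ℓ} → OccurrenceSequence a ℓ → RecursUniformly a ℓ
recursUniformly E =
    (λ N → let i , N<fi , _ = next N in pos i , <⇒≤ N<fi , occurs i)
  , pos 0 + gap , λ p _ → let i , p<fi , fi≤p+G = next p in pos i , p<fi , fi≤p+G , occurs i
  where
  open OccurrenceSequence E
  next : ∀ p → Σ ℕ λ i → p < pos i × pos i ≤ p + (pos 0 + gap)
  next = bounded-gaps pos pos-< pos-gap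

occurrenceSequence : UniformlyRecurrent → ∀ a ℓ →
                     Σ (OccurrenceSequence a ℓ) λ E → OccurrenceSequence.pos E 0 ≡ a
occurrenceSequence ur a ℓ = record
  { pos     = λ i → proj₁ (occurrence i)
  ; gap     = G
  ; pos-<   = λ i → proj₁ (step-spec (occurrence i))
  ; pos-gap = λ i → proj₂ (step-spec (occurrence i))
  ; occurs  = λ i → proj₂ (occurrence i)
  } , refl
  where
  G : ℕ
  G = proj₁ (proj₂ (ur a ℓ))
  next : ∀ p → OccursAt a ℓ p → Σ ℕ λ q → p < q × q ≤ p + G × OccursAt a ℓ q
  next = proj₂ (proj₂ (ur a ℓ))
  step : Σ ℕ (OccursAt a ℓ) → Σ ℕ (OccursAt a ℓ)
  step (p , occ) = let q , _ , _ , occ-q = next p occ in q , occ-q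
  step-spec : ∀ o → proj₁ o < proj₁ (step o) × proj₁ (step o) ≤ proj₁ o + G
  step-spec (p , occ) = let _ , p<q , q≤p+G , _ = next p occ in p<q , q≤p+G
  occurrence : ℕ → Σ ℕ (OccursAt a ℓ)
  occurrence zero    = a , λ _ _ → refl
  occurrence (suc i) = step (occurrence i)

BoundedRegularFactorization : ℕ → Set
BoundedRegularFactorization k =
  Σ ℕ λ M → 1 ≤ M ×
  Σ (ℕ → List Letter) λ w →
    (∀ i → 1 ≤ length (w i) × length (w i) ≤ M)
    × IsFactorization w
    × (∀ i → Regular k (start w i , length (w i)))

block : (ℕ → ℕ) → ℕ → List Letter
block X i = applyUpTo (λ j → kol (X i + j)) (X (suc i) ∸ X i)

start-block : ∀ {X} → X 0 ≡ 0 → (∀ i → X i ≤ X (suc i)) → ∀ i → start (block X) i ≡ X i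
start-block X0≡0 X-mono zero    = sym X0≡0
start-block X0≡0 X-mono (suc i) =
  trans (cong₂ _+_ (start-block X0≡0 X-mono i) (length-applyUpTo _ _)) (m+[n∸m]≡n (X-mono i))

blocks-factorization : ∀ {X k M} → X 0 ≡ 0 → (∀ i → X i < X (suc i)) →
                       (∀ i → X (suc i) ∸ X i ≤ M) → (∀ i → EvenIntegrals k (X i)) →
                       BoundedRegularFactorization k
blocks-factorization {X} {k} {M} X0≡0 X-< X-gap X-even =
  M , ≤-trans (m<n⇒0<n∸m (X-< 0)) (X-gap 0) , block X , lengths , factorization , regular
  where
  start≡X : ∀ i → start (block X) i ≡ X i
  start≡X = start-block X0≡0 (λ i → <⇒≤ (X-< i))
  lengths : ∀ i → 1 ≤ length (block X i) × length (block X i) ≤ M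
  lengths i = subst (λ L → 1 ≤ L × L ≤ M) (sym (length-applyUpTo _ _)) (m<n⇒0<n∸m (X-< i) , X-gap i)
  factorization : IsFactorization (block X)
  factorization i j = trans (lookup-applyUpTo (λ j → kol (X i + j)) (X (suc i) ∸ X i) j)
                            (cong (λ s → kol (s + toℕ j)) (sym (start≡X i)))
  regular : ∀ i → Regular k (start (block X) i , length (block X i))
  regular i = subst₂ (λ s L → Regular k (s , L)) (sym (start≡X i)) (sym (length-applyUpTo _ _))
                (regular-between (<⇒≤ (X-< i)) (X-even i) (X-even (suc i)))

uniformlyRecurrent⇒regularFactorization : UniformlyRecurrent → ∀ k → BoundedRegularFactorization k
uniformlyRecurrent⇒regularFactorization ur k with occurrenceSequence ur 0 (derivableLength k)
... | E , pos0≡0 = blocks-factorization X0≡0 X-< X-gap X-even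
  where
  open OccurrenceSequence E
  tower : ∀ i → Σ ℕ λ x → W^ (suc k) x ≡ pos i × EvenIntegrals k x
  tower i = prefix-occurrence-is-iterated-integral k (occurs i)
  X : ℕ → ℕ
  X i = proj₁ (tower i)
  W^X≡pos : ∀ i → W^ (suc k) (X i) ≡ pos i
  W^X≡pos i = proj₁ (proj₂ (tower i))
  X-even : ∀ i → EvenIntegrals k (X i)
  X-even i = proj₂ (proj₂ (tower i))
  X-< : ∀ i → X i < X (suc i)
  X-< i = expanding-cancel-< (W^-expanding (suc k))
            (subst₂ _<_ (sym (W^X≡pos i)) (sym (W^X≡pos (suc i))) (pos-< i))
  X-gap : ∀ i → X (suc i) ∸ X i ≤ gap
  X-gap i = expanding-gap (W^-expanding (suc k)) (<⇒≤ (X-< i))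
              (subst₂ (λ u v → u ≤ v + gap) (sym (W^X≡pos (suc i))) (sym (W^X≡pos i)) (pos-gap i))
  X0≡0 : X 0 ≡ 0
  X0≡0 = n≤0⇒n≡0 (begin
    X 0                         ≤⟨ m≤n+m (X 0) (W^ (suc k) 0) ⟩
    W^ (suc k) 0 + X 0          ≤⟨ W^-expanding (suc k) 0 (X 0) ⟩
    W^ (suc k) (X 0)            ≡⟨ trans (W^X≡pos 0) pos0≡0 ⟩
    0                           ∎)
    where open ≤-Reasoning

regularFactorization⇒uniformlyRecurrent :
  (∀ n → 1 ≤ n → Σ ℕ λ k → n < k × BoundedRegularFactorization k) → UniformlyRecurrent
regularFactorization⇒uniformlyRecurrent H a ℓ with H (suc (a + ℓ)) (s≤s z≤n)
... | k , J<k , M , _ , w , lengths , _ , regular = recursUniformly {a} {ℓ} record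
  { pos = pos ; gap = 2 ^ h * M ; pos-< = pos-< ; pos-gap = pos-gap ; occurs = occurs }
  where
  J h : ℕ
  J = a + ℓ
  h = suc (suc J)
  s : ℕ → ℕ
  s = start w
  s-even : ∀ i → EvenIntegrals k (s i)
  s-even zero    = EvenIntegrals-0 k
  s-even (suc i) = regular-extends (regular i) (s-even i)
  pos : ℕ → ℕ
  pos i = W^ h (s i) + a
  pos-< : ∀ i → pos i < pos (suc i)
  pos-< i = +-monoˡ-< a (expanding-strict (W^-expanding h) (m<m+n (s i) (proj₁ (lengths i))))
  pos-gap : ∀ i → pos (suc i) ≤ pos i + 2 ^ h * M
  pos-gap i = begin
    W^ h (s i + length (w i)) + a
      ≤⟨ +-monoˡ-≤ a (W^-+-≤ h (s i) (length (w i))) ⟩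
    W^ h (s i) + 2 ^ h * length (w i) + a
      ≤⟨ +-monoˡ-≤ a (+-monoʳ-≤ (W^ h (s i)) (*-monoʳ-≤ (2 ^ h) (proj₂ (lengths i)))) ⟩
    W^ h (s i) + 2 ^ h * M + a
      ≡⟨ xy∙z≈xz∙y (W^ h (s i)) (2 ^ h * M) a ⟩
    W^ h (s i) + a + 2 ^ h * M ∎
    where open ≤-Reasoning
  occurs : ∀ i → OccursAt a ℓ (pos i)
  occurs i = OccursAt-factor (W^ h (s i)) a (prefix-at-W^ J (EvenIntegrals-≤ (<⇒≤ J<k) (s-even i)))
               (≤-trans (m≤m+n J 2) (j+2≤W^j2 J))

lemma11 : UniformlyRecurrent ⇔
    (∀ n → 1 ≤ n →
      Σ ℕ λ k → n < k ×
      Σ ℕ λ M → 1 ≤ M ×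
      Σ (ℕ → List Letter) λ w →
        (∀ i → 1 ≤ length (w i) × length (w i) ≤ M)
        × IsFactorization w
        × (∀ i → Regular k (start w i , length (w i))))
lemma11 = mk⇔
  (λ ur n _ → suc n , ≤-refl , uniformlyRecurrent⇒regularFactorization ur (suc n))
  regularFactorization⇒uniformlyRecurrent
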